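{- Let $\mathcal{G}=(V,E,\mathcal{E})$ be an extended graph and let $v\in V$ satisfy $\deg(v)=1$ with $N(v)=\{u\}$ and $\deg_2(v)\le\deg(u)-1$. Then $v$ is contained in some maximum 2-packing set of $\mathcal{G}$. Consequently, with $\mathcal{G}'=\mathcal{G}[V\setminus N^2[v]]$, we have $\beta(\mathcal{G})=\beta(\mathcal{G}')+1$.
   Context: Let $H=(V_H,E_H)$ be a finite simple undirected graph and let $\mathcal{E}_H$ be the set of unordered pairs $\{x,y\}$ of distinct vertices with $\{x,y\}\notin E_H$ that have a common neighbor in $H$. An extended graph $\mathcal{G}=(V,E,\mathcal{E})$ is obtained from such an $H$ by choosing $V\subseteq V_H$ and letting $E$ (resp. $\mathcal{E}$) be the pairs of $E_H$ (resp. $\mathcal{E}_H$) with both endpoints in $V$. For $U\subseteq V$, $\mathcal{G}[U]$ denotes the extended graph on $U$ keeping exactly the pairs of $E$ and of $\mathcal{E}$ with both endpoints in $U$. For $v\in V$: $N(v)=\{x:\{x,v\}\in E\}$, $N[v]=N(v)\cup\{v\}$, $\deg(v)=|N(v)|$, $N^2(v)=\{x:\{x,v\}\in\mathcal{E}\}$, $N^2[v]=N^2(v)\cup N[v]$, $\deg_2(v)=|N^2(v)|$. A 2-packing set of $\mathcal{G}$ is a set $S\subseteq V$ such that no two distinct vertices of $S$ form a pair in $E\cup\mathcal{E}$; a maximum 2-packing set is one of maximum cardinality, and $\beta(\mathcal{G})$ is this maximum cardinality. -}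

module Defs where

open import Data.Nat using (ℕ; _≤_)
open import Data.Bool using (Bool; true; false; _∧_; not)
open import Data.Fin using (Fin; _≟_)
open import Data.Fin.Subset using (Subset; _∈_; _⊆_; _∪_; ⁅_⁆; ∣_∣)
open import Data.Vec using (lookup; tabulate)
open import Data.List using (allFin)
open import Data.Bool.ListAction using (any)
open import Data.Product using (Σ; _×_)
open import Relation.Nullary using (¬_)
open import Relation.Nullary.Decidable using (⌊_⌋)
open import Relation.Binary.PropositionalEquality using (_≡_)

record SimpleGraph (n : ℕ) : Set where
  field
    adj    : Fin n → Fin n → Bool
    sym    : ∀ x y → adj x y ≡ adj y x
    irrefl : ∀ x → adj x x ≡ false
open SimpleGraph public

-- An extended graph: a host simple graph H together with a chosen vertex set V ⊆ V_H.
-- E and 𝓔 are the pairs of E_H resp. 𝓔_H with both endpoints in V.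
record ExtGraph (n : ℕ) : Set where
  field
    host : SimpleGraph n
    V    : Subset n
open ExtGraph public

module _ {n : ℕ} (G : ExtGraph n) where
  private
    a = adj (host G)
    inV : Fin n → Bool
    inV x = lookup (V G) x

  isE : Fin n → Fin n → Bool
  isE x y = inV x ∧ inV y ∧ a x y

  -- {x,y} ∈ 𝓔 : distinct, non-adjacent in H, with a common neighbour in H (anywhere in V_H)
  isE₂ : Fin n → Fin n → Bool
  isE₂ x y = inV x ∧ inV y ∧ not ⌊ x ≟ y ⌋ ∧ not (a x y)
             ∧ any (λ w → a x w ∧ a w y) (allFin n)

  N : Fin n → Subset n
  N v = tabulate (λ x → isE x v)

  N² : Fin n → Subset n
  N² v = tabulate (λ x → isE₂ x v)

  N²[_] : Fin n → Subset n
  N²[ v ] = N² v ∪ (N v ∪ ⁅ v ⁆)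

  deg : Fin n → ℕ
  deg v = ∣ N v ∣

  deg₂ : Fin n → ℕ
  deg₂ v = ∣ N² v ∣

  Is2Packing : Subset n → Set
  Is2Packing S = S ⊆ V G ×
    (∀ x y → x ∈ S → y ∈ S → ¬ (x ≡ y) → (isE x y ≡ false) × (isE₂ x y ≡ false))

  IsMax2Packing : Subset n → Set
  IsMax2Packing S = Is2Packing S × (∀ T → Is2Packing T → ∣ T ∣ ≤ ∣ S ∣)

  IsBeta : ℕ → Set
  IsBeta k = Σ (Subset n) (λ S → IsMax2Packing S × ∣ S ∣ ≡ k)

induced : ∀ {n} → ExtGraph n → Subset n → ExtGraph n
induced G U = record { host = host G ; V = U }

-- Call x, y in conflict when {x,y} ∈ E ∪ 𝓔, i.e. when they cannot both lie in a 2-packing.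
-- As v is pendant at u, every other neighbour of u is at distance two from v, so
-- N(u) ∖ {v} ⊆ N²(v); the degree hypothesis turns this into an equality. Hence every vertex in
-- conflict with v lies in the closed neighbourhood N[u], whose vertices are pairwise in
-- conflict. A 2-packing therefore meets N[u] at most once, and replacing that vertex by v keeps
-- it a 2-packing of the same size; so some maximum 2-packing contains v. Removing v from it
-- gives a maximum 2-packing of 𝒢[V ∖ N²[v]], and adding v to any 2-packing of that graph gives
-- a 2-packing of 𝒢, whence β(𝒢) = β(𝒢') + 1.
module Submission where

open import Defs hiding (sym)
open import Data.Nat using (ℕ; suc; _≤_; _∸_)
open import Data.Fin using (Fin)
open import Data.Fin.Subset using (Subset; _∈_; _─_; ⁅_⁆)
open import Data.Product using (Σ; _×_)
open import Relation.Binary.PropositionalEquality using (_≡_)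

open import Data.Nat as ℕ using (zero; z≤n)
open import Data.Nat.Properties
  using (≤-trans; ≤-reflexive; ≤-antisym; ≤-pred; ≤∧≢⇒<; <-irrefl; ≤-<-trans; n≤1+n; suc-injective; module ≤-Reasoning)
open import Data.Bool using (Bool; true; false; _∧_; not) renaming (_≟_ to _≟ᵇ_)
open import Data.Bool.Properties using (∧-assoc; ∧-comm; not-¬; ¬-not; T-≡)
open import Data.Bool.ListAction using (or)
open import Data.Fin using (zero; suc; _≟_)
open import Data.Fin.Properties using (all?; any?)
open import Data.Fin.Subset using (_∉_; _∪_; _-_; _⊆_; ∣_∣) renaming (⊥ to ∅)
open import Data.Fin.Subset.Properties
  using (_∈?_; _⊆?_; p─⊥≡p; ∪-identityʳ; anySubset?; ∉⊥; ∣p∣≤n; x∈⁅x⁆; x∈⁅y⁆⇒x≡y; x∉⁅y⁆⇒x≢y; x∈p∪q⁺; x∈p∪q⁻;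
         p─q⊆p; x∈p∧x∉q⇒x∈p─q; x∈p∧x≢y⇒x∈p-y; p⊆q⇒∣p∣≤∣q∣; x∈p⇒∣p-x∣<∣p∣)
open import Data.Vec using (_∷_; here; there; lookup; tabulate)
open import Data.Vec.Properties using ([]=⇒lookup; lookup⇒[]=; lookup∘tabulate)
open import Data.List using (allFin)
open import Data.List.Properties using (map-cong)
open import Data.List.Membership.Propositional using (lose)
open import Data.List.Membership.Propositional.Properties using (∈-allFin)
open import Data.List.Relation.Unary.Any.Properties using (any⁺)
open import Data.Product using (_,_; proj₁; proj₂; Σ-syntax)
open import Data.Sum using (_⊎_; inj₁; inj₂)
open import Function using (_∘_; Equivalence)
open import Level using (Level)
open import Relation.Nullary using (¬_; yes; no; contradiction; _×-dec_; _→-dec_; ¬?)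
open import Relation.Nullary.Decidable using (⌊_⌋)
open import Relation.Unary using (Pred; Decidable)
open import Relation.Binary.PropositionalEquality using (_≢_; refl; sym; trans; cong; cong₂; subst)

private
  variable
    n : ℕ
    x y : Fin n
    p q : Subset n

x∈p─q⇒x∉q : x ∈ p ─ q → x ∉ q
x∈p─q⇒x∉q {p = _ ∷ p} {q = true  ∷ q} (there x∈p─q) (there x∈q) = x∈p─q⇒x∉q x∈p─q x∈q
x∈p─q⇒x∉q {p = _ ∷ p} {q = false ∷ q} (there x∈p─q) (there x∈q) = x∈p─q⇒x∉q x∈p─q x∈q

x∈p⇒∣p∣≡1+∣p-x∣ : x ∈ p → ∣ p ∣ ≡ suc ∣ p - x ∣
x∈p⇒∣p∣≡1+∣p-x∣ {p = true ∷ p}  here      = cong (suc ∘ ∣_∣) (sym (p─⊥≡p p))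
x∈p⇒∣p∣≡1+∣p-x∣ {p = true ∷ p}  (there i) = cong suc (x∈p⇒∣p∣≡1+∣p-x∣ i)
x∈p⇒∣p∣≡1+∣p-x∣ {p = false ∷ p} (there i) = x∈p⇒∣p∣≡1+∣p-x∣ i

x∉p⇒∣p∪⁅x⁆∣≡1+∣p∣ : x ∉ p → ∣ p ∪ ⁅ x ⁆ ∣ ≡ suc ∣ p ∣
x∉p⇒∣p∪⁅x⁆∣≡1+∣p∣ {x = zero}  {true  ∷ p} x∉p = contradiction here x∉p
x∉p⇒∣p∪⁅x⁆∣≡1+∣p∣ {x = zero}  {false ∷ p} x∉p = cong (suc ∘ ∣_∣) (∪-identityʳ p)
x∉p⇒∣p∪⁅x⁆∣≡1+∣p∣ {x = suc x} {true  ∷ p} x∉p = cong suc (x∉p⇒∣p∪⁅x⁆∣≡1+∣p∣ (x∉p ∘ there))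
x∉p⇒∣p∪⁅x⁆∣≡1+∣p∣ {x = suc x} {false ∷ p} x∉p = x∉p⇒∣p∪⁅x⁆∣≡1+∣p∣ (x∉p ∘ there)

p⊆q∧∣q∣≤∣p∣⇒q⊆p : p ⊆ q → ∣ q ∣ ≤ ∣ p ∣ → q ⊆ p
p⊆q∧∣q∣≤∣p∣⇒q⊆p {p = p} {q} p⊆q ∣q∣≤∣p∣ {x} x∈q with x ∈? p
... | yes x∈p = x∈p
... | no  x∉p = contradiction (≤-<-trans ∣q∣≤∣p∣ (≤-<-trans ∣p∣≤∣q-x∣ (x∈p⇒∣p-x∣<∣p∣ x∈q))) (<-irrefl refl)
  where
  ∣p∣≤∣q-x∣ : ∣ p ∣ ≤ ∣ q - x ∣
  ∣p∣≤∣q-x∣ = p⊆q⇒∣p∣≤∣q∣ {q = q - x} λ y∈p → x∈p∧x≢y⇒x∈p-y (p⊆q y∈p) λ { refl → x∉p y∈p }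

∈-tabulate⁺ : ∀ {f : Fin n → Bool} → f x ≡ true → x ∈ tabulate f
∈-tabulate⁺ {x = x} {f} fx = lookup⇒[]= x _ (trans (lookup∘tabulate f x) fx)

∈-tabulate⁻ : ∀ {f : Fin n → Bool} → x ∈ tabulate f → f x ≡ true
∈-tabulate⁻ {x = x} {f} x∈ = trans (sym (lookup∘tabulate f x)) ([]=⇒lookup x∈)

∧≡true⇒ : ∀ {b c} → b ∧ c ≡ true → b ≡ true × c ≡ true
∧≡true⇒ {true} {true} refl = refl , refl

∧-swapˡ : ∀ b c d → b ∧ c ∧ d ≡ c ∧ b ∧ d
∧-swapˡ b c d = trans (sym (∧-assoc b c d)) (trans (cong (_∧ d) (∧-comm b c)) (∧-assoc c b d))

⌊≟⌋-sym : ∀ (x y : Fin n) → ⌊ x ≟ y ⌋ ≡ ⌊ y ≟ x ⌋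
⌊≟⌋-sym x y with x ≟ y | y ≟ x
... | yes _   | yes _   = refl
... | no  _   | no  _   = refl
... | yes x≡y | no  y≢x = contradiction (sym x≡y) y≢x
... | no  x≢y | yes y≡x = contradiction (sym y≡x) x≢y

module _ {ℓ : Level} {P : Pred (Subset n) ℓ} (P? : Decidable P) where

  maximum≤ : ∀ m → (∀ T → P T → ∣ T ∣ ≤ m) → Σ[ S ∈ Subset n ] P S →
             Σ[ S ∈ Subset n ] P S × (∀ T → P T → ∣ T ∣ ≤ ∣ S ∣)
  maximum≤ zero    bound (S , pS) = S , pS , λ T pT → ≤-trans (bound T pT) z≤n
  maximum≤ (suc m) bound witness with anySubset? (λ T → P? T ×-dec (∣ T ∣ ℕ.≟ suc m))
  ... | yes (S , pS , ∣S∣≡1+m) = S , pS , λ T pT → subst (∣ T ∣ ≤_) (sym ∣S∣≡1+m) (bound T pT)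
  ... | no  ∄S = maximum≤ m (λ T pT → ≤-pred (≤∧≢⇒< (bound T pT) λ eq → ∄S (T , pT , eq))) witness

  maximum : Σ[ S ∈ Subset n ] P S → Σ[ S ∈ Subset n ] P S × (∀ T → P T → ∣ T ∣ ≤ ∣ S ∣)
  maximum = maximum≤ n (λ T _ → ∣p∣≤n T)

module _ {n : ℕ} (G : ExtGraph n) where
  private
    a : Fin n → Fin n → Bool
    a = adj (host G)

    adj-sym : ∀ x y → a x y ≡ a y x
    adj-sym = SimpleGraph.sym (host G)

  isE-sym : ∀ x y → isE G x y ≡ isE G y x
  isE-sym x y = trans (∧-swapˡ (lookup (V G) x) (lookup (V G) y) (a x y))
                      (cong (lookup (V G) y ∧_) (cong (lookup (V G) x ∧_) (adj-sym x y)))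

  isE₂-sym : ∀ x y → isE₂ G x y ≡ isE₂ G y x
  isE₂-sym x y = trans (∧-swapˡ (lookup (V G) x) (lookup (V G) y) _)
    (cong (lookup (V G) y ∧_) (cong (lookup (V G) x ∧_)
      (cong₂ _∧_ (cong not (⌊≟⌋-sym x y))
        (cong₂ _∧_ (cong not (adj-sym x y)) (cong or (map-cong common-sym (allFin n)))))))
    where
    common-sym : ∀ w → (a x w ∧ a w y) ≡ (a y w ∧ a w x)
    common-sym w = trans (∧-comm (a x w) (a w y)) (cong₂ _∧_ (adj-sym w y) (adj-sym x w))

  isE⁺ : x ∈ V G → y ∈ V G → a x y ≡ true → isE G x y ≡ true
  isE⁺ x∈V y∈V axy rewrite []=⇒lookup x∈V | []=⇒lookup y∈V = axy

  isE⁻ : isE G x y ≡ true → x ∈ V G × y ∈ V G × a x y ≡ true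
  isE⁻ {x = x} {y} e =
    let (vx , rest) = ∧≡true⇒ e
        (vy , axy)  = ∧≡true⇒ rest
    in lookup⇒[]= x (V G) vx , lookup⇒[]= y (V G) vy , axy

  isE₂⁺ : ∀ {x y} w → x ∈ V G → y ∈ V G → x ≢ y → a x y ≡ false →
          a x w ≡ true → a w y ≡ true → isE₂ G x y ≡ true
  isE₂⁺ {x} {y} w x∈V y∈V x≢y axy axw awy
    rewrite []=⇒lookup x∈V | []=⇒lookup y∈V | axy with x ≟ y
  ... | yes x≡y = contradiction x≡y x≢y
  ... | no  _   = Equivalence.to T-≡ (any⁺ _ (lose (∈-allFin w) (Equivalence.from T-≡ (cong₂ _∧_ axw awy))))

  Conflict : Fin n → Fin n → Set
  Conflict x y = isE G x y ≡ true ⊎ isE₂ G x y ≡ true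

  common-neighbour⇒conflict : ∀ {x y} w → x ∈ V G → y ∈ V G → x ≢ y →
                              a x w ≡ true → a w y ≡ true → Conflict x y
  common-neighbour⇒conflict {x} {y} w x∈V y∈V x≢y axw awy with a x y ≟ᵇ true
  ... | yes axy = inj₁ (isE⁺ x∈V y∈V axy)
  ... | no  axy = inj₂ (isE₂⁺ w x∈V y∈V x≢y (¬-not axy) axw awy)

  conflict-sym : Conflict x y → Conflict y x
  conflict-sym {x = x} {y} (inj₁ e) = inj₁ (trans (isE-sym y x) e)
  conflict-sym {x = x} {y} (inj₂ e) = inj₂ (trans (isE₂-sym y x) e)

  conflict⇒∈N²[] : ∀ {v} → Conflict x v → x ∈ N²[_] G v
  conflict⇒∈N²[] (inj₁ e) = x∈p∪q⁺ (inj₂ (x∈p∪q⁺ (inj₁ (∈-tabulate⁺ e))))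
  conflict⇒∈N²[] (inj₂ e) = x∈p∪q⁺ (inj₁ (∈-tabulate⁺ e))

  ∈N²[]⇒conflict : ∀ {v} → x ∈ N²[_] G v → Conflict x v ⊎ x ≡ v
  ∈N²[]⇒conflict {v = v} x∈ with x∈p∪q⁻ (N² G v) _ x∈
  ... | inj₁ x∈N² = inj₁ (inj₂ (∈-tabulate⁻ x∈N²))
  ... | inj₂ x∈N[] with x∈p∪q⁻ (N G v) _ x∈N[]
  ...   | inj₁ x∈N   = inj₁ (inj₁ (∈-tabulate⁻ x∈N))
  ...   | inj₂ x∈⁅v⁆ = inj₂ (x∈⁅y⁆⇒x≡y v x∈⁅v⁆)

  packing⇒¬conflict : ∀ {S} → Is2Packing G S → x ∈ S → y ∈ S → x ≢ y → ¬ Conflict x y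
  packing⇒¬conflict (_ , sep) x∈S y∈S x≢y (inj₁ e) = not-¬ e (proj₁ (sep _ _ x∈S y∈S x≢y))
  packing⇒¬conflict (_ , sep) x∈S y∈S x≢y (inj₂ e) = not-¬ e (proj₂ (sep _ _ x∈S y∈S x≢y))

  ¬conflict⇒packing : ∀ {S} → S ⊆ V G → (∀ {x y} → x ∈ S → y ∈ S → x ≢ y → ¬ Conflict x y) →
                      Is2Packing G S
  ¬conflict⇒packing S⊆V ok = S⊆V , λ x y x∈S y∈S x≢y →
    ¬-not (ok x∈S y∈S x≢y ∘ inj₁) , ¬-not (ok x∈S y∈S x≢y ∘ inj₂)

  packing? : Decidable (Is2Packing G)
  packing? S = (S ⊆? V G) ×-dec all? λ x → all? λ y →
    (x ∈? S) →-dec (y ∈? S) →-dec ¬? (x ≟ y) →-dec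
      ((isE G x y ≟ᵇ false) ×-dec (isE₂ G x y ≟ᵇ false))

  ∅-packing : Is2Packing G ∅
  ∅-packing = (λ x∈∅ → contradiction x∈∅ ∉⊥) , λ _ _ x∈∅ → contradiction x∈∅ ∉⊥

  packing-⊆ : ∀ {R T} → R ⊆ T → Is2Packing G T → Is2Packing G R
  packing-⊆ R⊆T (T⊆V , sep) = T⊆V ∘ R⊆T , λ x y x∈R y∈R → sep x y (R⊆T x∈R) (R⊆T y∈R)

  packing-∪⁅⁆ : ∀ {R v} → v ∈ V G → Is2Packing G R → (∀ {y} → y ∈ R → ¬ Conflict y v) →
                Is2Packing G (R ∪ ⁅ v ⁆)
  packing-∪⁅⁆ {R} {v} v∈V pR free = ¬conflict⇒packing R∪v⊆V ok
    where
    R∪v⊆V : R ∪ ⁅ v ⁆ ⊆ V G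
    R∪v⊆V x∈ with x∈p∪q⁻ R ⁅ v ⁆ x∈
    ... | inj₁ x∈R   = proj₁ pR x∈R
    ... | inj₂ x∈⁅v⁆ = subst (_∈ V G) (sym (x∈⁅y⁆⇒x≡y v x∈⁅v⁆)) v∈V
    ok : ∀ {x y} → x ∈ R ∪ ⁅ v ⁆ → y ∈ R ∪ ⁅ v ⁆ → x ≢ y → ¬ Conflict x y
    ok x∈ y∈ x≢y with x∈p∪q⁻ R ⁅ v ⁆ x∈ | x∈p∪q⁻ R ⁅ v ⁆ y∈
    ... | inj₁ x∈R   | inj₁ y∈R   = packing⇒¬conflict pR x∈R y∈R x≢y
    ... | inj₁ x∈R   | inj₂ y∈⁅v⁆ rewrite x∈⁅y⁆⇒x≡y v y∈⁅v⁆ = free x∈R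
    ... | inj₂ x∈⁅v⁆ | inj₁ y∈R   rewrite x∈⁅y⁆⇒x≡y v x∈⁅v⁆ = free y∈R ∘ conflict-sym
    ... | inj₂ x∈⁅v⁆ | inj₂ y∈⁅v⁆ = contradiction (trans (x∈⁅y⁆⇒x≡y v x∈⁅v⁆) (sym (x∈⁅y⁆⇒x≡y v y∈⁅v⁆))) x≢y

  maximum-packing-unique : ∀ {S T} → IsMax2Packing G S → IsMax2Packing G T → ∣ S ∣ ≡ ∣ T ∣
  maximum-packing-unique (pS , maxS) (pT , maxT) = ≤-antisym (maxT _ pS) (maxS _ pT)

  ConflictClique : Subset n → Set
  ConflictClique C = ∀ {x y} → x ∈ C → y ∈ C → x ≢ y → Conflict x y

  closed-neighbourhood-clique : ∀ u → ConflictClique (N G u ∪ ⁅ u ⁆)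
  closed-neighbourhood-clique u {x} {y} x∈ y∈ x≢y with x∈p∪q⁻ (N G u) _ x∈ | x∈p∪q⁻ (N G u) _ y∈
  ... | inj₁ x∈N   | inj₂ y∈⁅u⁆ rewrite x∈⁅y⁆⇒x≡y u y∈⁅u⁆ = inj₁ (∈-tabulate⁻ x∈N)
  ... | inj₂ x∈⁅u⁆ | inj₁ y∈N   rewrite x∈⁅y⁆⇒x≡y u x∈⁅u⁆ = inj₁ (trans (isE-sym u y) (∈-tabulate⁻ y∈N))
  ... | inj₂ x∈⁅u⁆ | inj₂ y∈⁅u⁆ = contradiction (trans (x∈⁅y⁆⇒x≡y u x∈⁅u⁆) (sym (x∈⁅y⁆⇒x≡y u y∈⁅u⁆))) x≢y
  ... | inj₁ x∈N   | inj₁ y∈N   =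
    let (x∈V , _ , axu) = isE⁻ (∈-tabulate⁻ x∈N)
        (y∈V , _ , ayu) = isE⁻ (∈-tabulate⁻ y∈N)
    in common-neighbour⇒conflict u x∈V y∈V x≢y axu (trans (adj-sym u y) ayu)

  packing-meets-clique-once : ∀ {C T} → ConflictClique C → Is2Packing G T →
    Σ[ R ∈ Subset n ] R ⊆ T × (∀ {y} → y ∈ R → y ∉ C) × ∣ T ∣ ≤ suc ∣ R ∣
  packing-meets-clique-once {C} {T} clique pT with any? (λ w → (w ∈? T) ×-dec (w ∈? C))
  ... | yes (w , w∈T , w∈C) = T - w , p─q⊆p T ⁅ w ⁆ , avoids , ≤-reflexive (x∈p⇒∣p∣≡1+∣p-x∣ w∈T)
    where
    avoids : ∀ {y} → y ∈ T - w → y ∉ C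
    avoids y∈T-w y∈C = packing⇒¬conflict pT (p─q⊆p T ⁅ w ⁆ y∈T-w) w∈T y≢w (clique y∈C w∈C y≢w)
      where
      y≢w : _ ≢ w
      y≢w = x∉⁅y⁆⇒x≢y (x∈p─q⇒x∉q y∈T-w)
  ... | no  ∄w = T , (λ y∈T → y∈T) , (λ y∈T y∈C → ∄w (_ , y∈T , y∈C)) , n≤1+n ∣ T ∣

  module _ {v C} (v∈V : v ∈ V G) (v∈C : v ∈ C) (clique : ConflictClique C)
           (covers : ∀ {y} → Conflict y v → y ∈ C) where

    exchange : ∀ {T} → Is2Packing G T → Σ[ T′ ∈ Subset n ] Is2Packing G T′ × v ∈ T′ × ∣ T ∣ ≤ ∣ T′ ∣
    exchange pT with packing-meets-clique-once clique pT
    ... | R , R⊆T , avoids , ∣T∣≤1+∣R∣ =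
      R ∪ ⁅ v ⁆ , packing-∪⁅⁆ v∈V (packing-⊆ R⊆T pT) (λ y∈R → avoids y∈R ∘ covers) ,
      x∈p∪q⁺ (inj₂ (x∈⁅x⁆ v)) ,
      ≤-trans ∣T∣≤1+∣R∣ (≤-reflexive (sym (x∉p⇒∣p∪⁅x⁆∣≡1+∣p∣ λ v∈R → avoids v∈R v∈C)))

    ∈-maximum-packing : Σ[ S ∈ Subset n ] IsMax2Packing G S × v ∈ S
    ∈-maximum-packing =
      let (S₀ , pS₀ , maxS₀)        = maximum packing? (∅ , ∅-packing)
          (S , pS , v∈S , ∣S₀∣≤∣S∣) = exchange pS₀
      in S , (pS , λ T pT → ≤-trans (maxS₀ T pT) ∣S₀∣≤∣S∣) , v∈S

module _ {n : ℕ} (G : ExtGraph n) {U : Subset n} (U⊆V : U ⊆ V G) where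

  isE-induced : x ∈ U → y ∈ U → isE (induced G U) x y ≡ isE G x y
  isE-induced x∈U y∈U
    rewrite []=⇒lookup x∈U | []=⇒lookup y∈U | []=⇒lookup (U⊆V x∈U) | []=⇒lookup (U⊆V y∈U) = refl

  isE₂-induced : x ∈ U → y ∈ U → isE₂ (induced G U) x y ≡ isE₂ G x y
  isE₂-induced x∈U y∈U
    rewrite []=⇒lookup x∈U | []=⇒lookup y∈U | []=⇒lookup (U⊆V x∈U) | []=⇒lookup (U⊆V y∈U) = refl

  packing-induced⁺ : ∀ {S} → S ⊆ U → Is2Packing G S → Is2Packing (induced G U) S
  packing-induced⁺ S⊆U (_ , sep) = S⊆U , λ x y x∈S y∈S x≢y →
    trans (isE-induced (S⊆U x∈S) (S⊆U y∈S)) (proj₁ (sep x y x∈S y∈S x≢y)) ,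
    trans (isE₂-induced (S⊆U x∈S) (S⊆U y∈S)) (proj₂ (sep x y x∈S y∈S x≢y))

  packing-induced⁻ : ∀ {S} → Is2Packing (induced G U) S → Is2Packing G S
  packing-induced⁻ (S⊆U , sep) = U⊆V ∘ S⊆U , λ x y x∈S y∈S x≢y →
    trans (sym (isE-induced (S⊆U x∈S) (S⊆U y∈S))) (proj₁ (sep x y x∈S y∈S x≢y)) ,
    trans (sym (isE₂-induced (S⊆U x∈S) (S⊆U y∈S))) (proj₂ (sep x y x∈S y∈S x≢y))

module _ {n : ℕ} (G : ExtGraph n) {v : Fin n} (v∈V : v ∈ V G) where
  private
    G′ : ExtGraph n
    G′ = induced G (V G ─ N²[_] G v)

    V′⊆V : V G ─ N²[_] G v ⊆ V G
    V′⊆V = p─q⊆p (V G) (N²[_] G v)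

    v∉packing : ∀ {T} → Is2Packing G′ T → v ∉ T
    v∉packing (T⊆V′ , _) v∈T = x∈p─q⇒x∉q (T⊆V′ v∈T) (x∈p∪q⁺ (inj₂ (x∈p∪q⁺ (inj₂ (x∈⁅x⁆ v)))))

  packing-remove : ∀ {S} → Is2Packing G S → v ∈ S → Is2Packing G′ (S - v)
  packing-remove {S} pS v∈S = packing-induced⁺ G V′⊆V S-v⊆V′ (packing-⊆ G (p─q⊆p S ⁅ v ⁆) pS)
    where
    S-v⊆V′ : S - v ⊆ V G ─ N²[_] G v
    S-v⊆V′ {x} x∈S-v = x∈p∧x∉q⇒x∈p─q (proj₁ pS x∈S) x∉N²[v]
      where
      x∈S : x ∈ S
      x∈S = p─q⊆p S ⁅ v ⁆ x∈S-v
      x≢v : x ≢ v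
      x≢v = x∉⁅y⁆⇒x≢y (x∈p─q⇒x∉q x∈S-v)
      x∉N²[v] : x ∉ N²[_] G v
      x∉N²[v] x∈N²[v] with ∈N²[]⇒conflict G x∈N²[v]
      ... | inj₁ conflict = packing⇒¬conflict G pS x∈S v∈S x≢v conflict
      ... | inj₂ x≡v      = x≢v x≡v

  packing-insert : ∀ {T} → Is2Packing G′ T → Is2Packing G (T ∪ ⁅ v ⁆)
  packing-insert pT = packing-∪⁅⁆ G v∈V (packing-induced⁻ G V′⊆V pT)
    λ y∈T conflict → x∈p─q⇒x∉q (proj₁ pT y∈T) (conflict⇒∈N²[] G conflict)

  maximum-packing-remove : ∀ {S} → IsMax2Packing G S → v ∈ S → IsMax2Packing G′ (S - v)
  maximum-packing-remove {S} (pS , maxS) v∈S = packing-remove pS v∈S , λ T pT → ≤-pred (begin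
    suc ∣ T ∣       ≡⟨ sym (x∉p⇒∣p∪⁅x⁆∣≡1+∣p∣ (v∉packing pT)) ⟩
    ∣ T ∪ ⁅ v ⁆ ∣   ≤⟨ maxS _ (packing-insert pT) ⟩
    ∣ S ∣           ≡⟨ x∈p⇒∣p∣≡1+∣p-x∣ v∈S ⟩
    suc ∣ S - v ∣   ∎)
    where open ≤-Reasoning

  β-remove : ∀ {S} → IsMax2Packing G S → v ∈ S →
             ∀ k → (IsBeta G′ k → IsBeta G (suc k)) × (IsBeta G (suc k) → IsBeta G′ k)
  β-remove {S} maxS v∈S k = to , from
    where
    maxS-v : IsMax2Packing G′ (S - v)
    maxS-v = maximum-packing-remove maxS v∈S
    ∣S∣≡1+∣S-v∣ : ∣ S ∣ ≡ suc ∣ S - v ∣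
    ∣S∣≡1+∣S-v∣ = x∈p⇒∣p∣≡1+∣p-x∣ v∈S
    to : IsBeta G′ k → IsBeta G (suc k)
    to (T , maxT , ∣T∣≡k) =
      S , maxS , trans ∣S∣≡1+∣S-v∣ (cong suc (trans (maximum-packing-unique G′ maxS-v maxT) ∣T∣≡k))
    from : IsBeta G (suc k) → IsBeta G′ k
    from (T , maxT , ∣T∣≡1+k) =
      S - v , maxS-v , suc-injective (trans (sym ∣S∣≡1+∣S-v∣) (trans (maximum-packing-unique G maxS maxT) ∣T∣≡1+k))

module _ {n : ℕ} (G : ExtGraph n) {u v : Fin n} (v∈V : v ∈ V G) (Nv≡⁅u⁆ : N G v ≡ ⁅ u ⁆) where

  neighbour≡u : ∀ {x} → isE G x v ≡ true → x ≡ u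
  neighbour≡u e = x∈⁅y⁆⇒x≡y u (subst (_ ∈_) Nv≡⁅u⁆ (∈-tabulate⁺ e))

  u∈Nv : u ∈ N G v
  u∈Nv = subst (u ∈_) (sym Nv≡⁅u⁆) (x∈⁅x⁆ u)

  v∈Nu : v ∈ N G u
  v∈Nu = ∈-tabulate⁺ (trans (isE-sym G v u) (∈-tabulate⁻ u∈Nv))

  adj-u⇒¬adj-v : ∀ {x} → x ∈ V G → adj (host G) x u ≡ true → adj (host G) x v ≡ false
  adj-u⇒¬adj-v x∈V axu = ¬-not λ axv →
    not-¬ (subst (λ z → adj (host G) z u ≡ true) (neighbour≡u (isE⁺ G x∈V v∈V axv)) axu)
          (SimpleGraph.irrefl (host G) u)

  Nu-v⊆N²v : N G u - v ⊆ N² G v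
  Nu-v⊆N²v x∈Nu-v =
    let (x∈V , _ , axu) = isE⁻ G (∈-tabulate⁻ (p─q⊆p (N G u) ⁅ v ⁆ x∈Nu-v))
        (_ , _ , auv)   = isE⁻ G (∈-tabulate⁻ u∈Nv)
        x≢v             = x∉⁅y⁆⇒x≢y (x∈p─q⇒x∉q x∈Nu-v)
    in ∈-tabulate⁺ (isE₂⁺ G u x∈V v∈V x≢v (adj-u⇒¬adj-v x∈V axu) axu auv)

  N²v⊆Nu : deg₂ G v ≤ deg G u ∸ 1 → N² G v ⊆ N G u
  N²v⊆Nu deg₂≤ = p─q⊆p (N G u) ⁅ v ⁆ ∘ p⊆q∧∣q∣≤∣p∣⇒q⊆p Nu-v⊆N²v
    (≤-trans deg₂≤ (≤-reflexive (cong (_∸ 1) (x∈p⇒∣p∣≡1+∣p-x∣ v∈Nu))))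

  conflict⇒∈N[u] : deg₂ G v ≤ deg G u ∸ 1 → ∀ {y} → Conflict G y v → y ∈ N G u ∪ ⁅ u ⁆
  conflict⇒∈N[u] deg₂≤ (inj₁ e) = x∈p∪q⁺ (inj₂ (subst (_∈ ⁅ u ⁆) (sym (neighbour≡u e)) (x∈⁅x⁆ u)))
  conflict⇒∈N[u] deg₂≤ (inj₂ e) = x∈p∪q⁺ (inj₁ (N²v⊆Nu deg₂≤ (∈-tabulate⁺ e)))

mainTheorem6 : ∀ {n} (G : ExtGraph n) (v u : Fin n) →
    v ∈ V G → deg G v ≡ 1 → N G v ≡ ⁅ u ⁆ → deg₂ G v ≤ deg G u ∸ 1 →
    Σ (Subset n) (λ S → IsMax2Packing G S × v ∈ S)
    × (∀ (k : ℕ) → (IsBeta (induced G (V G ─ N²[_] G v)) k → IsBeta G (suc k))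
                 × (IsBeta G (suc k) → IsBeta (induced G (V G ─ N²[_] G v)) k))
mainTheorem6 G v u v∈V _ Nv≡⁅u⁆ deg₂≤ =
  let (S , maxS , v∈S) = ∈-maximum-packing G v∈V (x∈p∪q⁺ (inj₁ (v∈Nu G v∈V Nv≡⁅u⁆)))
                           (closed-neighbourhood-clique G u) (conflict⇒∈N[u] G v∈V Nv≡⁅u⁆ deg₂≤)
  in (S , maxS , v∈S) , β-remove G v∈V maxS v∈S
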